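{- In the ordinal setting on $n$ vertices, for every vector $\vec c=(c_1,\dots,c_n)\in[0,1]^n$, the algorithm $\mathrm{ALG}_{\vec c}$ matches the top two vertices (overall) to each other with probability at most $\frac{5}{12}+O(1/n)$, where the implied constant is absolute.
   Context: Ordinal setting: $n$ vertices are ranked by an unknown total ranking from 1st to $n$th (the 1st and 2nd overall are the top two vertices); they arrive in a uniformly random order $v_1,\dots,v_n$; upon arrival of $v_t$ the algorithm observes only the relative rank of $v_t$ among $v_1,\dots,v_t$ and must immediately and irrevocably decide whether to match it to an earlier unmatched vertex. For each $i$ let $\mathrm{I}_i,\mathrm{II}_i$ denote the highest- and second-highest-ranked vertices among $v_1,\dots,v_i$. Algorithm $\mathrm{ALG}_{\vec c}$: at each step $i$, if matching $\mathrm{I}_i$ with $\mathrm{II}_i$ is possible (that is, $v_i\in\{\mathrm{I}_i,\mathrm{II}_i\}$ and both $\mathrm{I}_i$ and $\mathrm{II}_i$ are unmatched), then with probability $c_i$ (independently) it matches $\mathrm{I}_i$ with $\mathrm{II}_i$; otherwise, and in all other steps, it matches nothing. The probability is over the random arrival order and the algorithm's randomness.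
   Formalization: The vector $\vec c$ has rational entries, and the implied constant is taken to be rational. -}

module Defs where

open import Data.Bool using (Bool; true; false; if_then_else_; _∧_; _∨_; not)
open import Data.Nat as ℕ using (ℕ; zero; suc; _<ᵇ_; _≡ᵇ_)
open import Data.List using (List; []; _∷_; map; concatMap; upTo; filter; foldr; length)
open import Data.Bool.ListAction using (any)
open import Data.Product using (_×_; _,_)
open import Data.Integer using (+_)
open import Data.Rational using (ℚ; 0ℚ; 1ℚ; _+_; _*_; _-_; _/_)
import Data.List.Relation.Unary.Unique.DecPropositional as UniqueDec

-- Convention: a vertex is identified with its overall rank, 0 = best (1st),
-- 1 = second best, ..., n-1 = worst.  An arrival order v_1..v_n is the list
-- of overall ranks of v_1, ..., v_n, i.e. a list of n distinct elements of
-- {0,..,n-1}.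

allSeqs : ℕ → ℕ → List (List ℕ)
allSeqs zero    m = [] ∷ []
allSeqs (suc k) m = concatMap (λ xs → map (λ x → x ∷ xs) (upTo m)) (allSeqs k m)

arrivalOrders : ℕ → List (List ℕ)
arrivalOrders n = filter (UniqueDec.unique? ℕ._≟_) (allSeqs n n)

-- the best and second best among the vertices arrived so far
data Top2 : Set where
  none : Top2
  one  : ℕ → Top2
  two  : ℕ → ℕ → Top2     -- two I II  (I better than II)

insertTop : ℕ → Top2 → Top2
insertTop x none      = one x
insertTop x (one a)   = if x <ᵇ a then two x a else two a x
insertTop x (two a b) = if x <ᵇ a then two x a else (if x <ᵇ b then two a x else two a b)

Matching : Set
Matching = List (ℕ × ℕ)

isMatched : ℕ → Matching → Bool
isMatched v m = any (λ { (p , q) → (v ≡ᵇ p) ∨ (v ≡ᵇ q) }) m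

topTwoMatched : Matching → Bool
topTwoMatched m = any (λ { (p , q) → ((p ≡ᵇ 0) ∧ (q ≡ᵇ 1)) ∨ ((p ≡ᵇ 1) ∧ (q ≡ᵇ 0)) }) m

indicator : Bool → ℚ
indicator true  = 1ℚ
indicator false = 0ℚ

-- Probability (over the algorithm's coins) that ALG_c, run on the remaining
-- arrivals, ends with the top two vertices matched to each other, given the
-- current top-two among arrived vertices and current matching.  Step i consumes c_i and v_i together.
simulate : Top2 → Matching → List ℚ → List ℕ → ℚ
simulate t m (c ∷ cs) (v ∷ vs) with insertTop v t
... | two a b =
  if ((v ≡ᵇ a) ∨ (v ≡ᵇ b)) ∧ not (isMatched a m) ∧ not (isMatched b m)
  then c * simulate (two a b) ((a , b) ∷ m) cs vs
         + (1ℚ - c) * simulate (two a b) m cs vs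
  else simulate (two a b) m cs vs
... | t' = simulate t' m cs vs
simulate t m _ _ = indicator (topTwoMatched m)

average : List ℚ → ℚ
average xs with length xs
... | zero  = 0ℚ
... | suc k = foldr _+_ 0ℚ xs * ((+ 1) / suc k)

-- Pr[ALG_c matches the top two vertices to each other], arrival order
-- uniform over all n! orders, coins independent.
successProb : (n : ℕ) → List ℚ → ℚ
successProb n c = average (map (simulate none [] c) (arrivalOrders n))

-- 1/n  (with 1/0 := 0; only used for n ≥ 1)
inv : ℕ → ℚ
inv zero    = 0ℚ
inv (suc k) = (+ 1) / suc k

-- After t arrivals the state of the algorithm matters only through the class of its current
-- top two I, II: I unmatched (free), I matched to II (paired), or I matched to another vertex
-- (taken).  Given the rank x of the last of t + 1 arrivals among them, the first t arrivals form
-- a uniformly random order of their own, relabelled by punching x in.  So the class counts N_t,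
-- summed over all t! orders and weighted by the coin flips, obey a linear recursion
-- N_{t+1} = grow_t(c_{t+1}) N_t, and the success probability is N_n(paired) / n!.
-- Let W(n, t) be 3n(n-1)(n-2) times the class-wise success probability when, after t arrivals,
-- every possible match is made.  For 2t >= n and any c, N_{t+1} . W(n, t+1) <= (t+1) N_t . W(n, t),
-- while the total of N grows by exactly the factor t + 1; at t = n the potential equals
-- 3n(n-1)(n-2) N_n(paired).  At t = ceil(n/2), where W(n, t) is about (5/4, 5/4, 1/2) n^3, every
-- entry of W(n, t) is at most (5/4) n(n-1)(n-2) + 6(n-1)(n-2), which gives 5/12 + 2/n.
{-# OPTIONS --safe #-}
module Submission where

open import Defs
open import Data.Nat using (ℕ; _≤_)
open import Data.Fin using (Fin)
open import Data.Vec using (Vec; lookup; toList)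
open import Data.Product using (Σ; _×_)
open import Data.Integer using (+_)
open import Data.Rational using (ℚ; 0ℚ; 1ℚ; _+_; _*_; _/_) renaming (_≤_ to _≤ℚ_)

open import Data.Bool using (Bool; true; false; if_then_else_; _∧_; _∨_; not)
import Data.Bool.Properties as Bool
open import Data.Fin as Fin using (toℕ)
import Data.Fin.Properties as Fin
import Data.Integer as ℤ
import Data.Integer.Tactic.RingSolver as ℤ-Solver
open import Data.List
  using (List; []; _∷_; _++_; _∷ʳ_; map; concatMap; filter; foldr; applyUpTo; upTo; length; take; drop; initLast; _∷ʳ′_)
import Data.List.Properties as List
open import Data.List.Relation.Unary.All as All using (All; []; _∷_)
import Data.List.Relation.Unary.All.Properties as All
open import Data.Nat as ℕ using (zero; suc; _≡ᵇ_; _<ᵇ_; _≟_; z≤n; s≤s)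
import Data.Nat.Coprimality as Coprime
import Data.Nat.Properties as ℕ
open import Data.List.Membership.DecPropositional _≟_ using (_∈?_)
open import Data.List.Relation.Unary.Unique.DecPropositional _≟_ using (unique?)
open import Data.Product using (_,_; proj₂)
open import Data.Rational using (_-_; -_; _<_; mkℚ; toℚᵘ; positive; nonNegative)
import Data.Rational.Properties as ℚ
import Data.Rational.Unnormalised as ℚᵘ
import Data.Rational.Unnormalised.Properties as ℚᵘ
open import Algebra.Properties.CommutativeMonoid.Sum ℚ.+-0-commutativeMonoid
  using (sum-syntax; sum-cong-≗; ∑-comm; ∑-distrib-+; sum-replicate-zero)
open import Data.Sum using (_⊎_; inj₁; inj₂)
import Data.Vec as Vec
import Data.Vec.Properties as Vec
import Data.Vec.Relation.Unary.All.Properties as VecAll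
open import Function using (_∘_)
open import Level using (0ℓ)
open import Relation.Binary using (DecidableEquality)
open import Relation.Binary.PropositionalEquality
open import Relation.Nullary using (does; ¬?; yes; no; contradiction)
open import Relation.Nullary.Decidable as Dec using (dec⇒maybe)
open import Relation.Unary using (Decidable)
open import Tactic.RingSolver using (solve-∀)
open import Tactic.RingSolver.Core.AlmostCommutativeRing using (AlmostCommutativeRing; fromCommutativeRing)

ℚ-ring : AlmostCommutativeRing 0ℓ 0ℓ
ℚ-ring = fromCommutativeRing ℚ.+-*-commutativeRing (λ x → dec⇒maybe (0ℚ ℚ.≟ x))

p≤p+q : ∀ p {q} → 0ℚ ≤ℚ q → p ≤ℚ p + q
p≤p+q p 0≤q = ℚ.≤-trans (ℚ.≤-reflexive (sym (ℚ.+-identityʳ p))) (ℚ.+-monoʳ-≤ p 0≤q)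

≤-by-slack : ∀ {p q} d → 0ℚ ≤ℚ d → q ≡ p + d → p ≤ℚ q
≤-by-slack {p} d 0≤d q≡p+d = ℚ.≤-trans (p≤p+q p 0≤d) (ℚ.≤-reflexive (sym q≡p+d))

0≤+ : ∀ {p q} → 0ℚ ≤ℚ p → 0ℚ ≤ℚ q → 0ℚ ≤ℚ p + q
0≤+ 0≤p 0≤q = ℚ.+-mono-≤ 0≤p 0≤q

0≤* : ∀ {p q} → 0ℚ ≤ℚ p → 0ℚ ≤ℚ q → 0ℚ ≤ℚ p * q
0≤* {p} {q} 0≤p 0≤q =
  ℚ.nonNegative⁻¹ _ {{ℚ.nonNeg*nonNeg⇒nonNeg p {{nonNegative 0≤p}} q {{nonNegative 0≤q}}}}

0≤- : ∀ {p q} → p ≤ℚ q → 0ℚ ≤ℚ q - p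
0≤- {p} p≤q = ℚ.≤-trans (ℚ.≤-reflexive (sym (ℚ.+-inverseʳ p))) (ℚ.+-monoˡ-≤ (- p) p≤q)

*-monoˡ-≤ : ∀ {r p q} → 0ℚ ≤ℚ r → p ≤ℚ q → r * p ≤ℚ r * q
*-monoˡ-≤ {r} 0≤r = ℚ.*-monoˡ-≤-nonNeg r {{nonNegative 0≤r}}

-- By recursion, so that fromℕ (suc n) unfolds to 1ℚ + fromℕ n for the ring solver.
fromℕ : ℕ → ℚ
fromℕ zero    = 0ℚ
fromℕ (suc n) = 1ℚ + fromℕ n

fromℕ-+ : ∀ m n → fromℕ (m ℕ.+ n) ≡ fromℕ m + fromℕ n
fromℕ-+ zero    n = sym (ℚ.+-identityˡ (fromℕ n))
fromℕ-+ (suc m) n = trans (cong (λ x → 1ℚ + x) (fromℕ-+ m n)) (sym (ℚ.+-assoc 1ℚ (fromℕ m) (fromℕ n)))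

0≤fromℕ : ∀ n → 0ℚ ≤ℚ fromℕ n
0≤fromℕ zero    = ℚ.≤-refl
0≤fromℕ (suc n) = 0≤+ (ℚ.nonNegative⁻¹ 1ℚ) (0≤fromℕ n)

fromℕ-mono-≤ : ∀ {m n} → m ≤ n → fromℕ m ≤ℚ fromℕ n
fromℕ-mono-≤ {m} m≤n with ℕ.m≤n⇒∃[o]m+o≡n m≤n
... | o , refl = ≤-by-slack (fromℕ o) (0≤fromℕ o) (fromℕ-+ m o)

fromℕ*inv≡1 : ∀ k → fromℕ (suc k) * inv (suc k) ≡ 1ℚ
fromℕ*inv≡1 k = trans (cong₂ _*_ (fromℕ≡mkℚ k) (ℚ.normalize-coprime (Coprime.1-coprimeTo (suc k))))
                      (ℚ.*-inverseʳ (mkℚ (+ suc k) 0 (Coprime.sym (Coprime.1-coprimeTo (suc k)))))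
  where
  toℚᵘ-fromℕ : ∀ n → toℚᵘ (fromℕ n) ℚᵘ.≃ ℚᵘ.mkℚᵘ (+ n) 0
  toℚᵘ-fromℕ zero    = ℚᵘ.≃-refl
  toℚᵘ-fromℕ (suc n) = ℚᵘ.≃-trans (ℚ.toℚᵘ-homo-+ 1ℚ (fromℕ n))
    (ℚᵘ.≃-trans (ℚᵘ.+-congʳ (toℚᵘ 1ℚ) (toℚᵘ-fromℕ n)) (ℚᵘ.*≡* (cross-multiplied (+ n))))
    where
    cross-multiplied : ∀ x → ((+ 1 ℤ.* + 1) ℤ.+ (x ℤ.* + 1)) ℤ.* + 1 ≡ (+ 1 ℤ.+ x) ℤ.* + 1
    cross-multiplied = ℤ-Solver.solve-∀
  fromℕ≡mkℚ : ∀ k → fromℕ (suc k) ≡ mkℚ (+ suc k) 0 (Coprime.sym (Coprime.1-coprimeTo (suc k)))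
  fromℕ≡mkℚ k = ℚ.toℚᵘ-injective (toℚᵘ-fromℕ (suc k))

∑ : List ℚ → ℚ
∑ = foldr _+_ 0ℚ

∑-syntax : {A : Set} → List A → (A → ℚ) → ℚ
∑-syntax xs f = ∑ (map f xs)

infixl 10 ∑-syntax
syntax ∑-syntax xs (λ x → e) = ∑[ x ∈ xs ] e

private variable
  A B : Set

∑-cong : ∀ {f g : A → ℚ} {xs} → All (λ x → f x ≡ g x) xs → ∑[ x ∈ xs ] f x ≡ ∑[ x ∈ xs ] g x
∑-cong []         = refl
∑-cong (eq ∷ eqs) = cong₂ _+_ eq (∑-cong eqs)

∑-cong-≗ : ∀ {f g : A → ℚ} → (∀ x → f x ≡ g x) → ∀ xs → ∑[ x ∈ xs ] f x ≡ ∑[ x ∈ xs ] g x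
∑-cong-≗ f≗g xs = cong ∑ (List.map-cong f≗g xs)

∑-++ : ∀ xs ys (f : A → ℚ) → ∑[ x ∈ xs ++ ys ] f x ≡ ∑[ x ∈ xs ] f x + ∑[ x ∈ ys ] f x
∑-++ []       ys f = sym (ℚ.+-identityˡ _)
∑-++ (x ∷ xs) ys f = trans (cong (λ s → f x + s) (∑-++ xs ys f)) (sym (ℚ.+-assoc (f x) _ _))

∑-concatMap : ∀ (g : A → List B) (f : B → ℚ) xs →
              ∑[ y ∈ concatMap g xs ] f y ≡ ∑[ x ∈ xs ] ∑[ y ∈ g x ] f y
∑-concatMap g f []       = refl
∑-concatMap g f (x ∷ xs) =
  trans (∑-++ (g x) (concatMap g xs) f) (cong (λ s → ∑[ y ∈ g x ] f y + s) (∑-concatMap g f xs))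

∑-filter : ∀ {P : A → Set} (P? : Decidable P) (f : A → ℚ) xs →
           ∑[ x ∈ filter P? xs ] f x ≡ ∑[ x ∈ xs ] (if does (P? x) then f x else 0ℚ)
∑-filter P? f []       = refl
∑-filter P? f (x ∷ xs) with does (P? x)
... | true  = cong (λ s → f x + s) (∑-filter P? f xs)
... | false = trans (∑-filter P? f xs) (sym (ℚ.+-identityˡ _))

∑-nonneg : ∀ {f : A → ℚ} {xs} → All (λ x → 0ℚ ≤ℚ f x) xs → 0ℚ ≤ℚ ∑[ x ∈ xs ] f x
∑-nonneg []         = ℚ.≤-refl
∑-nonneg (px ∷ pxs) = ℚ.+-mono-≤ px (∑-nonneg pxs)

∑-nonneg-≡0 : ∀ {f : A → ℚ} {xs} → All (λ x → 0ℚ ≤ℚ f x) xs → ∑[ x ∈ xs ] f x ≡ 0ℚ →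
              All (λ x → f x ≡ 0ℚ) xs
∑-nonneg-≡0                  []         _     = []
∑-nonneg-≡0 {f = f} {x ∷ xs} (px ∷ pxs) sum≡0 = fx≡0 ∷ ∑-nonneg-≡0 pxs rest≡0
  where
  fx≡0 : f x ≡ 0ℚ
  fx≡0 = ℚ.≤-antisym (ℚ.≤-trans (p≤p+q (f x) (∑-nonneg pxs)) (ℚ.≤-reflexive sum≡0)) px
  rest≡0 : ∑[ y ∈ xs ] f y ≡ 0ℚ
  rest≡0 = trans (sym (ℚ.+-identityˡ _)) (trans (cong (_+ ∑[ y ∈ xs ] f y) (sym fx≡0)) sum≡0)

∑-∑-comm : ∀ {n} (f : A → Fin n → ℚ) xs → ∑[ x ∈ xs ] ∑[ i < n ] f x i ≡ ∑[ i < n ] ∑[ x ∈ xs ] f x i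
∑-∑-comm {n = n} f []       = sym (sum-replicate-zero n)
∑-∑-comm {n = n} f (x ∷ xs) =
  trans (cong (λ s → ∑[ i < n ] f x i + s) (∑-∑-comm f xs)) (sym (∑-distrib-+ (f x) _))

∑-applyUpTo : ∀ (f : ℕ → ℚ) g n → ∑[ y ∈ applyUpTo g n ] f y ≡ ∑[ i < n ] f (g (toℕ i))
∑-applyUpTo f g zero    = refl
∑-applyUpTo f g (suc n) = cong (λ s → f (g 0) + s) (∑-applyUpTo f (g ∘ suc) n)

∑-const : ∀ k a → ∑[ i < k ] a ≡ fromℕ k * a
∑-const zero    a = sym (ℚ.*-zeroˡ a)
∑-const (suc k) a = trans (cong (λ s → a + s) (∑-const k a)) (distrib (fromℕ k) a)
  where
  distrib : ∀ e a → a + e * a ≡ (1ℚ + e) * a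
  distrib = solve-∀ ℚ-ring

-- Arrival orders, decomposed by the last arrival

≡ᵇ-sym : ∀ a b → (a ≡ᵇ b) ≡ (b ≡ᵇ a)
≡ᵇ-sym zero    zero    = refl
≡ᵇ-sym zero    (suc b) = refl
≡ᵇ-sym (suc a) zero    = refl
≡ᵇ-sym (suc a) (suc b) = ≡ᵇ-sym a b

punchIn : ℕ → ℕ → ℕ
punchIn zero    y       = suc y
punchIn (suc x) zero    = zero
punchIn (suc x) (suc y) = suc (punchIn x y)

punchIn-≡ᵇ : ∀ x a b → (punchIn x a ≡ᵇ punchIn x b) ≡ (a ≡ᵇ b)
punchIn-≡ᵇ zero    a       b       = refl
punchIn-≡ᵇ (suc x) zero    zero    = refl
punchIn-≡ᵇ (suc x) zero    (suc b) = refl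
punchIn-≡ᵇ (suc x) (suc a) zero    = refl
punchIn-≡ᵇ (suc x) (suc a) (suc b) = punchIn-≡ᵇ x a b

punchIn-<ᵇ : ∀ x a b → (punchIn x a <ᵇ punchIn x b) ≡ (a <ᵇ b)
punchIn-<ᵇ zero    a       b       = refl
punchIn-<ᵇ (suc x) zero    zero    = refl
punchIn-<ᵇ (suc x) zero    (suc b) = refl
punchIn-<ᵇ (suc x) (suc a) zero    = refl
punchIn-<ᵇ (suc x) (suc a) (suc b) = punchIn-<ᵇ x a b

punchInᵢ≢i : ∀ x y → (x ≡ᵇ punchIn x y) ≡ false
punchInᵢ≢i zero    y       = refl
punchInᵢ≢i (suc x) zero    = refl
punchInᵢ≢i (suc x) (suc y) = punchInᵢ≢i x y

∑-punchIn : ∀ {x t} → x ≤ t → (h : ℕ → ℚ) →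
            ∑[ y < suc t ] (if x ≡ᵇ toℕ y then 0ℚ else h (toℕ y)) ≡ ∑[ y < t ] h (punchIn x (toℕ y))
∑-punchIn {zero}  z≤n       h = ℚ.+-identityˡ _
∑-punchIn {suc x} (s≤s x≤t) h = cong (λ s → h 0 + s) (∑-punchIn x≤t (h ∘ suc))

∑-allSeqs-∷ : ∀ k m (F : List ℕ → ℚ) →
              ∑[ q ∈ allSeqs (suc k) m ] F q ≡ ∑[ q ∈ allSeqs k m ] ∑[ y < m ] F (toℕ y ∷ q)
∑-allSeqs-∷ k m F = begin
  ∑[ q ∈ concatMap (λ q → map (_∷ q) (upTo m)) (allSeqs k m) ] F q
    ≡⟨ ∑-concatMap (λ q → map (_∷ q) (upTo m)) F (allSeqs k m) ⟩
  ∑[ q ∈ allSeqs k m ] ∑[ y ∈ map (_∷ q) (upTo m) ] F y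
    ≡⟨ ∑-cong-≗ (λ q → cong ∑ (sym (List.map-∘ (upTo m)))) (allSeqs k m) ⟩
  ∑[ q ∈ allSeqs k m ] ∑[ y ∈ upTo m ] F (y ∷ q)
    ≡⟨ ∑-cong-≗ (λ q → ∑-applyUpTo (λ y → F (y ∷ q)) (λ y → y) m) (allSeqs k m) ⟩
  ∑[ q ∈ allSeqs k m ] ∑[ y < m ] F (toℕ y ∷ q) ∎
  where open ≡-Reasoning

∑-allSeqs-∷ʳ : ∀ k m (F : List ℕ → ℚ) →
               ∑[ q ∈ allSeqs (suc k) m ] F q ≡ ∑[ q ∈ allSeqs k m ] ∑[ y < m ] F (q ∷ʳ toℕ y)
∑-allSeqs-∷ʳ zero    m F = ∑-allSeqs-∷ zero m F
∑-allSeqs-∷ʳ (suc k) m F = begin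
  ∑[ q ∈ allSeqs (suc (suc k)) m ] F q
    ≡⟨ ∑-allSeqs-∷ (suc k) m F ⟩
  ∑[ q ∈ allSeqs (suc k) m ] ∑[ y < m ] F (toℕ y ∷ q)
    ≡⟨ ∑-allSeqs-∷ʳ k m _ ⟩
  ∑[ q ∈ allSeqs k m ] ∑[ z < m ] ∑[ y < m ] F ((toℕ y ∷ q) ∷ʳ toℕ z)
    ≡⟨ ∑-cong-≗ (λ q → ∑-comm {m} {m} (λ z y → F ((toℕ y ∷ q) ∷ʳ toℕ z))) (allSeqs k m) ⟩
  ∑[ q ∈ allSeqs k m ] ∑[ y < m ] ∑[ z < m ] F ((toℕ y ∷ q) ∷ʳ toℕ z)
    ≡⟨ ∑-allSeqs-∷ k m _ ⟨
  ∑[ q ∈ allSeqs (suc k) m ] ∑[ z < m ] F (q ∷ʳ toℕ z) ∎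
  where open ≡-Reasoning

∑-allSeqs-avoiding : ∀ k {x t} → x ≤ t → (F : List ℕ → ℚ) →
                     ∑[ q ∈ allSeqs k (suc t) ] (if does (x ∈? q) then 0ℚ else F q)
                       ≡ ∑[ r ∈ allSeqs k t ] F (map (punchIn x) r)
∑-allSeqs-avoiding zero          x≤t F = refl
∑-allSeqs-avoiding (suc k) {x} {t} x≤t F = begin
  ∑[ q ∈ allSeqs (suc k) (suc t) ] (if does (x ∈? q) then 0ℚ else F q)
    ≡⟨ ∑-allSeqs-∷ k (suc t) _ ⟩
  ∑[ q ∈ allSeqs k (suc t) ] ∑[ y < suc t ] (if (x ≡ᵇ toℕ y) ∨ does (x ∈? q) then 0ℚ else F (toℕ y ∷ q))
    ≡⟨ ∑-cong-≗ (λ q → absent q (does (x ∈? q))) (allSeqs k (suc t)) ⟩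
  ∑[ q ∈ allSeqs k (suc t) ]
    (if does (x ∈? q) then 0ℚ else ∑[ y < suc t ] (if x ≡ᵇ toℕ y then 0ℚ else F (toℕ y ∷ q)))
    ≡⟨ ∑-allSeqs-avoiding k x≤t _ ⟩
  ∑[ r ∈ allSeqs k t ] ∑[ y < suc t ] (if x ≡ᵇ toℕ y then 0ℚ else F (toℕ y ∷ map (punchIn x) r))
    ≡⟨ ∑-cong-≗ (λ r → ∑-punchIn x≤t (λ y → F (y ∷ map (punchIn x) r))) (allSeqs k t) ⟩
  ∑[ r ∈ allSeqs k t ] ∑[ y < t ] F (punchIn x (toℕ y) ∷ map (punchIn x) r)
    ≡⟨ ∑-allSeqs-∷ k t _ ⟨
  ∑[ r ∈ allSeqs (suc k) t ] F (map (punchIn x) r) ∎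
  where
  open ≡-Reasoning
  absent : ∀ q b → ∑[ y < suc t ] (if (x ≡ᵇ toℕ y) ∨ b then 0ℚ else F (toℕ y ∷ q))
                   ≡ (if b then 0ℚ else ∑[ y < suc t ] (if x ≡ᵇ toℕ y then 0ℚ else F (toℕ y ∷ q)))
  absent q true  = trans (sum-cong-≗ {suc t} λ y → cong (λ b → if b then 0ℚ else F (toℕ y ∷ q))
                                                       (Bool.∨-zeroʳ (x ≡ᵇ toℕ y)))
                         (sum-replicate-zero (suc t))
  absent q false = sum-cong-≗ {suc t} λ y → cong (λ b → if b then 0ℚ else F (toℕ y ∷ q))
                                                 (Bool.∨-identityʳ (x ≡ᵇ toℕ y))

fresh? : ℕ → List ℕ → Bool
fresh? y ys = does (All.all? (λ z → ¬? (y ≟ z)) ys)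

fresh?-∷ʳ : ∀ y ys x → fresh? y (ys ∷ʳ x) ≡ fresh? y ys ∧ not (y ≡ᵇ x)
fresh?-∷ʳ y []       x = Bool.∧-identityʳ _
fresh?-∷ʳ y (z ∷ zs) x =
  trans (cong (not (y ≡ᵇ z) ∧_) (fresh?-∷ʳ y zs x))
        (sym (Bool.∧-assoc (not (y ≡ᵇ z)) (fresh? y zs) (not (y ≡ᵇ x))))

unique?-∷ʳ : ∀ xs x → does (unique? (xs ∷ʳ x)) ≡ not (does (x ∈? xs)) ∧ does (unique? xs)
unique?-∷ʳ []       x = refl
unique?-∷ʳ (y ∷ ys) x rewrite fresh?-∷ʳ y ys x | unique?-∷ʳ ys x | ≡ᵇ-sym y x =
  shuffle (fresh? y ys) (x ≡ᵇ y) (does (x ∈? ys)) (does (unique? ys))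
  where
  shuffle : ∀ a e m u → (a ∧ not e) ∧ (not m ∧ u) ≡ not (e ∨ m) ∧ (a ∧ u)
  shuffle true  true  m     u = refl
  shuffle true  false true  u = refl
  shuffle true  false false u = refl
  shuffle false true  m     u = refl
  shuffle false false true  u = refl
  shuffle false false false u = refl

module _ (g : ℕ → ℕ) (g-≡ᵇ : ∀ a b → (g a ≡ᵇ g b) ≡ (a ≡ᵇ b)) where

  fresh?-map : ∀ a r → fresh? (g a) (map g r) ≡ fresh? a r
  fresh?-map a []      = refl
  fresh?-map a (b ∷ r) = cong₂ (λ e f → not e ∧ f) (g-≡ᵇ a b) (fresh?-map a r)

  unique?-map : ∀ r → does (unique? (map g r)) ≡ does (unique? r)
  unique?-map []      = refl
  unique?-map (a ∷ r) = cong₂ _∧_ (fresh?-map a r) (unique?-map r)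

∈?-map-punchIn : ∀ x r → does (x ∈? map (punchIn x) r) ≡ false
∈?-map-punchIn x []      = refl
∈?-map-punchIn x (y ∷ r) = cong₂ _∨_ (punchInᵢ≢i x y) (∈?-map-punchIn x r)

∑-arrivalOrders : ∀ n (F : List ℕ → ℚ) →
                  ∑[ q ∈ arrivalOrders n ] F q ≡ ∑[ q ∈ allSeqs n n ] (if does (unique? q) then F q else 0ℚ)
∑-arrivalOrders n F = ∑-filter unique? F (allSeqs n n)

∑-arrivalOrders-∷ʳ : ∀ t (F : List ℕ → ℚ) →
  ∑[ q ∈ arrivalOrders (suc t) ] F q ≡ ∑[ x < suc t ] ∑[ r ∈ arrivalOrders t ] F (map (punchIn (toℕ x)) r ∷ʳ toℕ x)
∑-arrivalOrders-∷ʳ t F = begin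
  ∑[ q ∈ arrivalOrders (suc t) ] F q
    ≡⟨ ∑-arrivalOrders (suc t) F ⟩
  ∑[ q ∈ allSeqs (suc t) (suc t) ] (if does (unique? q) then F q else 0ℚ)
    ≡⟨ ∑-allSeqs-∷ʳ t (suc t) _ ⟩
  ∑[ q ∈ allSeqs t (suc t) ] ∑[ x < suc t ] (if does (unique? (q ∷ʳ toℕ x)) then F (q ∷ʳ toℕ x) else 0ℚ)
    ≡⟨ ∑-cong-≗ (λ q → sum-cong-≗ {suc t} (λ x → last-fresh q (toℕ x))) (allSeqs t (suc t)) ⟩
  ∑[ q ∈ allSeqs t (suc t) ] ∑[ x < suc t ] (if does (toℕ x ∈? q) then 0ℚ else G x q)
    ≡⟨ ∑-∑-comm (λ q x → if does (toℕ x ∈? q) then 0ℚ else G x q) (allSeqs t (suc t)) ⟩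
  ∑[ x < suc t ] ∑[ q ∈ allSeqs t (suc t) ] (if does (toℕ x ∈? q) then 0ℚ else G x q)
    ≡⟨ sum-cong-≗ {suc t} (λ x → ∑-allSeqs-avoiding t (Fin.toℕ≤pred[n] x) (G x)) ⟩
  ∑[ x < suc t ] ∑[ r ∈ allSeqs t t ] G x (map (punchIn (toℕ x)) r)
    ≡⟨ sum-cong-≗ {suc t} (λ x → ∑-cong-≗ (relabel x) (allSeqs t t)) ⟩
  ∑[ x < suc t ] ∑[ r ∈ allSeqs t t ] (if does (unique? r) then F (map (punchIn (toℕ x)) r ∷ʳ toℕ x) else 0ℚ)
    ≡⟨ sum-cong-≗ {suc t} (λ x → ∑-arrivalOrders t (λ r → F (map (punchIn (toℕ x)) r ∷ʳ toℕ x))) ⟨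
  ∑[ x < suc t ] ∑[ r ∈ arrivalOrders t ] F (map (punchIn (toℕ x)) r ∷ʳ toℕ x) ∎
  where
  open ≡-Reasoning
  G : Fin (suc t) → List ℕ → ℚ
  G x q = if does (unique? q) then F (q ∷ʳ toℕ x) else 0ℚ
  last-fresh : ∀ q x → (if does (unique? (q ∷ʳ x)) then F (q ∷ʳ x) else 0ℚ)
                       ≡ (if does (x ∈? q) then 0ℚ else if does (unique? q) then F (q ∷ʳ x) else 0ℚ)
  last-fresh q x rewrite unique?-∷ʳ q x with does (x ∈? q)
  ... | true  = refl
  ... | false = refl
  relabel : ∀ x r → G x (map (punchIn (toℕ x)) r)
                    ≡ (if does (unique? r) then F (map (punchIn (toℕ x)) r ∷ʳ toℕ x) else 0ℚ)
  relabel x r = cong (λ b → if b then F (map (punchIn (toℕ x)) r ∷ʳ toℕ x) else 0ℚ)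
                     (unique?-map (punchIn (toℕ x)) (punchIn-≡ᵇ (toℕ x)) r)

-- The orders violating P are counted by a sum of nonnegative terms, which the
-- decomposition by the last arrival shows to be 0.
All-arrivalOrders-∷ʳ : ∀ {P : List ℕ → Set} (P? : Decidable P) t →
  (∀ (x : Fin (suc t)) → All (λ r → P (map (punchIn (toℕ x)) r ∷ʳ toℕ x)) (arrivalOrders t)) →
  All P (arrivalOrders (suc t))
All-arrivalOrders-∷ʳ {P} P? t P-last =
  All.map defect≡0⇒P (∑-nonneg-≡0 (All.universal defect-nonneg _) (begin
    ∑[ q ∈ arrivalOrders (suc t) ] defect q
      ≡⟨ ∑-arrivalOrders-∷ʳ t defect ⟩
    ∑[ x < suc t ] ∑[ r ∈ arrivalOrders t ] defect (map (punchIn (toℕ x)) r ∷ʳ toℕ x)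
      ≡⟨ sum-cong-≗ {suc t} (λ x → ∑-cong (All.map P⇒defect≡0 (P-last x))) ⟩
    ∑[ x < suc t ] ∑[ r ∈ arrivalOrders t ] 0ℚ
      ≡⟨ sum-cong-≗ {suc t} (λ x → ∑-zero (arrivalOrders t)) ⟩
    ∑[ x < suc t ] 0ℚ
      ≡⟨ sum-replicate-zero (suc t) ⟩
    0ℚ ∎))
  where
  open ≡-Reasoning
  defect : List ℕ → ℚ
  defect q = if does (P? q) then 0ℚ else 1ℚ
  defect-nonneg : ∀ q → 0ℚ ≤ℚ defect q
  defect-nonneg q with does (P? q)
  ... | true  = ℚ.≤-refl
  ... | false = ℚ.nonNegative⁻¹ 1ℚ
  P⇒defect≡0 : ∀ {q} → P q → defect q ≡ 0ℚ
  P⇒defect≡0 {q} Pq = cong (λ b → if b then 0ℚ else 1ℚ) (Dec.dec-true (P? q) Pq)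
  defect≡0⇒P : ∀ {q} → defect q ≡ 0ℚ → P q
  defect≡0⇒P {q} eq with P? q
  ... | yes Pq = Pq
  ... | no _   = contradiction eq λ ()
  ∑-zero : ∀ (xs : List (List ℕ)) → ∑[ x ∈ xs ] 0ℚ ≡ 0ℚ
  ∑-zero []       = refl
  ∑-zero (_ ∷ xs) = trans (ℚ.+-identityˡ _) (∑-zero xs)

-- States of the algorithm

topAfter : Top2 → List ℕ → Top2
topAfter s []       = s
topAfter s (v ∷ vs) = topAfter (insertTop v s) vs

topAfter-∷ʳ : ∀ s vs v → topAfter s (vs ∷ʳ v) ≡ insertTop v (topAfter s vs)
topAfter-∷ʳ s []       v = refl
topAfter-∷ʳ s (w ∷ vs) v = topAfter-∷ʳ (insertTop w s) vs v

topOfRange : ℕ → Top2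
topOfRange zero          = none
topOfRange (suc zero)    = one 0
topOfRange (suc (suc _)) = two 0 1

mapTop2 : (ℕ → ℕ) → Top2 → Top2
mapTop2 g none      = none
mapTop2 g (one a)   = one (g a)
mapTop2 g (two a b) = two (g a) (g b)

mapMatching : (ℕ → ℕ) → Matching → Matching
mapMatching g = map λ { (p , q) → g p , g q }

module _ (g : ℕ → ℕ) (g-<ᵇ : ∀ a b → (g a <ᵇ g b) ≡ (a <ᵇ b)) where

  insertTop-map : ∀ v s → insertTop (g v) (mapTop2 g s) ≡ mapTop2 g (insertTop v s)
  insertTop-map v none      = refl
  insertTop-map v (one a)   rewrite g-<ᵇ v a with v <ᵇ a
  ... | true  = refl
  ... | false = refl
  insertTop-map v (two a b) rewrite g-<ᵇ v a | g-<ᵇ v b with v <ᵇ a | v <ᵇ b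
  ... | true  | _     = refl
  ... | false | true  = refl
  ... | false | false = refl

  topAfter-map : ∀ s vs → topAfter (mapTop2 g s) (map g vs) ≡ mapTop2 g (topAfter s vs)
  topAfter-map s []       = refl
  topAfter-map s (v ∷ vs) rewrite insertTop-map v s = topAfter-map (insertTop v s) vs

insertTop-last : ∀ {x t} → x ≤ t → insertTop x (mapTop2 (punchIn x) (topOfRange t)) ≡ topOfRange (suc t)
insertTop-last {zero}        {zero}        _ = refl
insertTop-last {zero}        {suc zero}    _ = refl
insertTop-last {suc zero}    {suc zero}    _ = refl
insertTop-last {zero}        {suc (suc t)} _ = refl
insertTop-last {suc zero}    {suc (suc t)} _ = refl
insertTop-last {suc (suc x)} {suc (suc t)} _ = refl
insertTop-last {suc (suc x)} {suc zero}    (s≤s ())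

_≟ᵀ_ : DecidableEquality Top2
none    ≟ᵀ none    = yes refl
one a   ≟ᵀ one b   = Dec.map′ (cong one) (λ { refl → refl }) (a ≟ b)
two a b ≟ᵀ two c d =
  Dec.map′ (λ { (refl , refl) → refl }) (λ { refl → refl , refl }) (a ≟ c Dec.×-dec b ≟ d)
none    ≟ᵀ one _   = no λ ()
none    ≟ᵀ two _ _ = no λ ()
one _   ≟ᵀ none    = no λ ()
one _   ≟ᵀ two _ _ = no λ ()
two _ _ ≟ᵀ none    = no λ ()
two _ _ ≟ᵀ one _   = no λ ()

arrivalOrders-length : ∀ t → All (λ q → length q ≡ t) (arrivalOrders t)
arrivalOrders-length zero    = refl ∷ []
arrivalOrders-length (suc t) =
  All-arrivalOrders-∷ʳ (λ q → length q ≟ suc t) t λ x → All.map (λ {r} → length-last x {r}) (arrivalOrders-length t)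
  where
  length-last : ∀ x {r} → length r ≡ t → length (map (punchIn (toℕ x)) r ∷ʳ toℕ x) ≡ suc t
  length-last x {r} len =
    trans (List.length-++ (map _ r)) (trans (ℕ.+-comm _ 1) (cong suc (trans (List.length-map _ r) len)))

arrivalOrders-top : ∀ t → All (λ q → topAfter none q ≡ topOfRange t) (arrivalOrders t)
arrivalOrders-top zero    = refl ∷ []
arrivalOrders-top (suc t) =
  All-arrivalOrders-∷ʳ (λ q → topAfter none q ≟ᵀ topOfRange (suc t)) t λ x →
    All.map (λ {r} → top-last (toℕ x) (Fin.toℕ≤pred[n] x) {r}) (arrivalOrders-top t)
  where
  open ≡-Reasoning
  top-last : ∀ x → x ≤ t → ∀ {r} → topAfter none r ≡ topOfRange t →
             topAfter none (map (punchIn x) r ∷ʳ x) ≡ topOfRange (suc t)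
  top-last x x≤t {r} top = begin
    topAfter none (map (punchIn x) r ∷ʳ x)
      ≡⟨ topAfter-∷ʳ none (map (punchIn x) r) x ⟩
    insertTop x (topAfter none (map (punchIn x) r))
      ≡⟨ cong (insertTop x) (topAfter-map (punchIn x) (punchIn-<ᵇ x) none r) ⟩
    insertTop x (mapTop2 (punchIn x) (topAfter none r))
      ≡⟨ cong (insertTop x ∘ mapTop2 (punchIn x)) top ⟩
    insertTop x (mapTop2 (punchIn x) (topOfRange t))
      ≡⟨ insertTop-last x≤t ⟩
    topOfRange (suc t) ∎

arrivalOrders-shape : ∀ t → All (λ q → length q ≡ t × topAfter none q ≡ topOfRange t) (arrivalOrders t)
arrivalOrders-shape t = All.zip (arrivalOrders-length t , arrivalOrders-top t)

data Class : Set where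
  free paired taken : Class

pairIn : ℕ → ℕ → Matching → Bool
pairIn a b []            = false
pairIn a b ((p , q) ∷ m) = (((p ≡ᵇ a) ∧ (q ≡ᵇ b)) ∨ ((p ≡ᵇ b) ∧ (q ≡ᵇ a))) ∨ pairIn a b m

classOf : Top2 → Matching → Class
classOf none      m = free
classOf (one a)   m = if isMatched a m then taken else free
classOf (two a b) m = if pairIn a b m then paired else if isMatched a m then taken else free

pairIn-sym : ∀ a b m → pairIn a b m ≡ pairIn b a m
pairIn-sym a b []            = refl
pairIn-sym a b ((p , q) ∷ m) =
  cong₂ _∨_ (Bool.∨-comm ((p ≡ᵇ a) ∧ (q ≡ᵇ b)) ((p ≡ᵇ b) ∧ (q ≡ᵇ a))) (pairIn-sym a b m)

pairIn-unmatched : ∀ a b m → isMatched a m ≡ false → pairIn a b m ≡ false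
pairIn-unmatched a b []            _  = refl
pairIn-unmatched a b ((p , q) ∷ m) eq with a ≡ᵇ p in ap | a ≡ᵇ q in aq
... | false | false rewrite ≡ᵇ-sym p a | ap | ≡ᵇ-sym q a | aq | Bool.∧-zeroʳ (p ≡ᵇ b) =
  pairIn-unmatched a b m eq
... | true  | _     = contradiction eq λ ()
... | false | true  = contradiction eq λ ()

topTwoMatched≡pairIn : ∀ m → topTwoMatched m ≡ pairIn 0 1 m
topTwoMatched≡pairIn []      = refl
topTwoMatched≡pairIn (_ ∷ m) = cong (_ ∨_) (topTwoMatched≡pairIn m)

module _ (g : ℕ → ℕ) (g-≡ᵇ : ∀ a b → (g a ≡ᵇ g b) ≡ (a ≡ᵇ b)) where

  isMatched-map : ∀ a m → isMatched (g a) (mapMatching g m) ≡ isMatched a m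
  isMatched-map a []            = refl
  isMatched-map a ((p , q) ∷ m) = cong₂ _∨_ (cong₂ _∨_ (g-≡ᵇ a p) (g-≡ᵇ a q)) (isMatched-map a m)

  pairIn-map : ∀ a b m → pairIn (g a) (g b) (mapMatching g m) ≡ pairIn a b m
  pairIn-map a b []            = refl
  pairIn-map a b ((p , q) ∷ m) rewrite g-≡ᵇ p a | g-≡ᵇ q b | g-≡ᵇ p b | g-≡ᵇ q a =
    cong (_ ∨_) (pairIn-map a b m)

  classOf-map : ∀ s m → classOf (mapTop2 g s) (mapMatching g m) ≡ classOf s m
  classOf-map none      m = refl
  classOf-map (one a)   m rewrite isMatched-map a m = refl
  classOf-map (two a b) m rewrite pairIn-map a b m | isMatched-map a m = refl

isMatched-punchIn : ∀ x m → isMatched x (mapMatching (punchIn x) m) ≡ false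
isMatched-punchIn x []            = refl
isMatched-punchIn x ((p , q) ∷ m) rewrite punchInᵢ≢i x p | punchInᵢ≢i x q = isMatched-punchIn x m

⟨_,_,_⟩ : ℚ → ℚ → ℚ → Class → ℚ
⟨ a , b , d ⟩ free   = a
⟨ a , b , d ⟩ paired = b
⟨ a , b , d ⟩ taken  = d

isFree : Class → Bool
isFree free = true
isFree _    = false

isFree-classOf : ∀ t m → isFree (classOf (topOfRange (suc t)) m) ≡ not (isMatched 0 m)
isFree-classOf zero    m with isMatched 0 m
... | true  = refl
... | false = refl
isFree-classOf (suc t) m with isMatched 0 m in matched
... | false rewrite pairIn-unmatched 0 1 m matched = refl
... | true  with pairIn 0 1 m
...   | true  = refl
...   | false = refl

-- The algorithm as a payoff transformer

Payoff : Set
Payoff = Top2 → Matching → ℚ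

canMatch : ℕ → ℕ → ℕ → Matching → Bool
canMatch v a b m = ((v ≡ᵇ a) ∨ (v ≡ᵇ b)) ∧ not (isMatched a m) ∧ not (isMatched b m)

decideAt : ℚ → ℕ → Payoff → Matching → Top2 → ℚ
decideAt c v P m (two a b) =
  if canMatch v a b m then c * P (two a b) ((a , b) ∷ m) + (1ℚ - c) * P (two a b) m else P (two a b) m
decideAt c v P m s = P s m

step : ℚ → ℕ → Payoff → Payoff
step c v P s m = decideAt c v P m (insertTop v s)

run : List ℚ → List ℕ → Payoff → Payoff
run (c ∷ cs) (v ∷ vs) P = step c v (run cs vs P)
run _        _        P = P

success : Payoff
success _ m = indicator (topTwoMatched m)

simulate≡run : ∀ cs vs s m → simulate s m cs vs ≡ run cs vs success s m
simulate≡run []       vs       s m = refl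
simulate≡run (c ∷ cs) []       s m = refl
simulate≡run (c ∷ cs) (v ∷ vs) s m with insertTop v s
... | none    = simulate≡run cs vs none m
... | one a   = simulate≡run cs vs (one a) m
... | two a b = cong₂ (λ x y → if canMatch v a b m then c * x + (1ℚ - c) * y else y)
                      (simulate≡run cs vs (two a b) ((a , b) ∷ m)) (simulate≡run cs vs (two a b) m)

run-∷ʳ : ∀ cs vs c v P → length cs ≡ length vs → run (cs ∷ʳ c) (vs ∷ʳ v) P ≡ run cs vs (step c v P)
run-∷ʳ []       []       c v P _   = refl
run-∷ʳ (_ ∷ cs) (_ ∷ vs) c v P len = cong (step _ _) (run-∷ʳ cs vs c v P (ℕ.suc-injective len))

decideAt-cong : ∀ c v {P Q} m s → (∀ m′ → P s m′ ≡ Q s m′) → decideAt c v P m s ≡ decideAt c v Q m s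
decideAt-cong c v m none      P≡Q = P≡Q m
decideAt-cong c v m (one a)   P≡Q = P≡Q m
decideAt-cong c v m (two a b) P≡Q =
  cong₂ (λ x y → if canMatch v a b m then c * x + (1ℚ - c) * y else y) (P≡Q ((a , b) ∷ m)) (P≡Q m)

run-cong : ∀ cs vs {P Q} s m → length cs ≡ length vs →
           (∀ m′ → P (topAfter s vs) m′ ≡ Q (topAfter s vs) m′) → run cs vs P s m ≡ run cs vs Q s m
run-cong []       []       s m _   P≡Q = P≡Q m
run-cong (c ∷ cs) (v ∷ vs) s m len P≡Q =
  decideAt-cong c v m (insertTop v s) λ m′ → run-cong cs vs (insertTop v s) m′ (ℕ.suc-injective len) P≡Q

run-one : ∀ cs vs s m → run cs vs (λ _ _ → 1ℚ) s m ≡ 1ℚ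
run-one []       vs       s m = refl
run-one (c ∷ cs) []       s m = refl
run-one (c ∷ cs) (v ∷ vs) s m =
  trans (decideAt-cong c v m (insertTop v s) (run-one cs vs (insertTop v s))) (decideAt-one (insertTop v s))
  where
  decideAt-one : ∀ s → decideAt c v (λ _ _ → 1ℚ) m s ≡ 1ℚ
  decideAt-one none      = refl
  decideAt-one (one _)   = refl
  decideAt-one (two a b) with canMatch v a b m
  ... | true  = coin c
    where
    coin : ∀ c → c * 1ℚ + (1ℚ - c) * 1ℚ ≡ 1ℚ
    coin = solve-∀ ℚ-ring
  ... | false = refl

relabel : (ℕ → ℕ) → Payoff → Payoff
relabel g P s m = P (mapTop2 g s) (mapMatching g m)

module _ (g : ℕ → ℕ) (g-≡ᵇ : ∀ a b → (g a ≡ᵇ g b) ≡ (a ≡ᵇ b)) where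

  decideAt-map : ∀ c v P m s → decideAt c (g v) P (mapMatching g m) (mapTop2 g s) ≡ decideAt c v (relabel g P) m s
  decideAt-map c v P m none      = refl
  decideAt-map c v P m (one a)   = refl
  decideAt-map c v P m (two a b) =
    cong (λ can → if can then _ else _)
         (cong₂ _∧_ (cong₂ _∨_ (g-≡ᵇ v a) (g-≡ᵇ v b))
                    (cong₂ (λ x y → not x ∧ not y) (isMatched-map g g-≡ᵇ a m) (isMatched-map g g-≡ᵇ b m)))

  module _ (g-<ᵇ : ∀ a b → (g a <ᵇ g b) ≡ (a <ᵇ b)) where

    run-map : ∀ cs vs P s m → run cs (map g vs) P (mapTop2 g s) (mapMatching g m) ≡ run cs vs (relabel g P) s m
    run-map []       vs       P s m = refl
    run-map (c ∷ cs) []       P s m = refl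
    run-map (c ∷ cs) (v ∷ vs) P s m = begin
      decideAt c (g v) (run cs (map g vs) P) (mapMatching g m) (insertTop (g v) (mapTop2 g s))
        ≡⟨ cong (decideAt c (g v) _ _) (insertTop-map g g-<ᵇ v s) ⟩
      decideAt c (g v) (run cs (map g vs) P) (mapMatching g m) (mapTop2 g (insertTop v s))
        ≡⟨ decideAt-map c v _ m (insertTop v s) ⟩
      decideAt c v (relabel g (run cs (map g vs) P)) m (insertTop v s)
        ≡⟨ decideAt-cong c v m (insertTop v s) (run-map cs vs P (insertTop v s)) ⟩
      decideAt c v (run cs vs (relabel g P)) m (insertTop v s) ∎
      where open ≡-Reasoning

-- Class payoffs and class counts

value : (Class → ℚ) → Payoff
value p s m = p (classOf s m)

mix : ℚ → (Class → ℚ) → ℚ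
mix c p = c * p paired + (1ℚ - c) * p free

pullback : ℕ → ℚ → ℕ → (Class → ℚ) → Class → ℚ
pullback (suc t) c zero       p k = if isFree k then mix c p else p free
pullback (suc t) c (suc zero) p k = if isFree k then mix c p else p taken
pullback _       c _          p k = p k

relabel-step-value : ∀ {x t} → x ≤ t → ∀ c p m →
  relabel (punchIn x) (step c x (value p)) (topOfRange t) m ≡ value (pullback t c x p) (topOfRange t) m
relabel-step-value {zero}        {zero}        _ c p m =
  cong (λ b → p (if b then taken else free)) (isMatched-punchIn 0 m)
relabel-step-value {zero}        {suc t}       _ c p m = begin
  decideAt c 0 (value p) m′ (insertTop 0 (mapTop2 (punchIn 0) (topOfRange (suc t))))
    ≡⟨ cong (decideAt c 0 (value p) m′) (insertTop-last {t = suc t} z≤n) ⟩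
  (if not (isMatched 0 m′) ∧ not (isMatched 1 m′)
   then c * p paired + (1ℚ - c) * value p (two 0 1) m′ else value p (two 0 1) m′)
    ≡⟨ cong₂ (λ can k → if can then c * p paired + (1ℚ - c) * p k else p k)
             (cong₂ (λ a b → not a ∧ not b) (isMatched-punchIn 0 m) (isMatched-map (punchIn 0) (punchIn-≡ᵇ 0) 0 m))
             class≡free ⟩
  (if not (isMatched 0 m) then mix c p else p free)
    ≡⟨ cong (λ b → if b then mix c p else p free) (isFree-classOf t m) ⟨
  value (pullback (suc t) c 0 p) (topOfRange (suc t)) m ∎
  where
  open ≡-Reasoning
  m′ = mapMatching (punchIn 0) m
  class≡free : classOf (two 0 1) m′ ≡ free
  class≡free rewrite pairIn-unmatched 0 1 m′ (isMatched-punchIn 0 m) | isMatched-punchIn 0 m = refl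
relabel-step-value {suc zero}    {suc t}       _ c p m = begin
  decideAt c 1 (value p) m′ (insertTop 1 (mapTop2 (punchIn 1) (topOfRange (suc t))))
    ≡⟨ cong (decideAt c 1 (value p) m′) (insertTop-last {t = suc t} (s≤s z≤n)) ⟩
  (if not (isMatched 0 m′) ∧ not (isMatched 1 m′)
   then c * p paired + (1ℚ - c) * value p (two 0 1) m′ else value p (two 0 1) m′)
    ≡⟨ cong₂ (λ can k → if can then c * p paired + (1ℚ - c) * p k else p k)
             (cong₂ (λ a b → not a ∧ not b) (isMatched-map (punchIn 1) (punchIn-≡ᵇ 1) 0 m) (isMatched-punchIn 1 m))
             class≡ ⟩
  (if not (isMatched 0 m) ∧ true then c * p paired + (1ℚ - c) * p (if isMatched 0 m then taken else free)
   else p (if isMatched 0 m then taken else free))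
    ≡⟨ by-cases (isMatched 0 m) ⟩
  (if not (isMatched 0 m) then mix c p else p taken)
    ≡⟨ cong (λ b → if b then mix c p else p taken) (isFree-classOf t m) ⟨
  value (pullback (suc t) c 1 p) (topOfRange (suc t)) m ∎
  where
  open ≡-Reasoning
  m′ = mapMatching (punchIn 1) m
  class≡ : classOf (two 0 1) m′ ≡ (if isMatched 0 m then taken else free)
  class≡ rewrite pairIn-sym 0 1 m′ | pairIn-unmatched 1 0 m′ (isMatched-punchIn 1 m)
               | isMatched-map (punchIn 1) (punchIn-≡ᵇ 1) 0 m = refl
  by-cases : ∀ b → (if not b ∧ true then c * p paired + (1ℚ - c) * p (if b then taken else free)
                    else p (if b then taken else free))
                   ≡ (if not b then mix c p else p taken)
  by-cases true  = refl
  by-cases false = refl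
relabel-step-value {suc (suc x)} {suc (suc t)} _ c p m =
  cong p (classOf-map (punchIn (suc (suc x))) (punchIn-≡ᵇ (suc (suc x))) (two 0 1) m)
relabel-step-value {suc (suc x)} {suc zero}    (s≤s ())

run-last-arrival : ∀ {x t} → x ≤ t → ∀ cs c p r → length cs ≡ t → length r ≡ t × topAfter none r ≡ topOfRange t →
  run (cs ∷ʳ c) (map (punchIn x) r ∷ʳ x) (value p) none [] ≡ run cs r (value (pullback t c x p)) none []
run-last-arrival {x} {t} x≤t cs c p r len-cs (len-r , top) = begin
  run (cs ∷ʳ c) (map (punchIn x) r ∷ʳ x) (value p) none []
    ≡⟨ cong (λ P → P none []) (run-∷ʳ cs (map (punchIn x) r) c x (value p) lengths) ⟩
  run cs (map (punchIn x) r) (step c x (value p)) none []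
    ≡⟨ run-map (punchIn x) (punchIn-≡ᵇ x) (punchIn-<ᵇ x) cs r (step c x (value p)) none [] ⟩
  run cs r (relabel (punchIn x) (step c x (value p))) none []
    ≡⟨ run-cong cs r none [] (trans len-cs (sym len-r)) at-end ⟩
  run cs r (value (pullback t c x p)) none [] ∎
  where
  open ≡-Reasoning
  lengths : length cs ≡ length (map (punchIn x) r)
  lengths = trans len-cs (sym (trans (List.length-map _ r) len-r))
  at-end : ∀ m → relabel (punchIn x) (step c x (value p)) (topAfter none r) m
                 ≡ value (pullback t c x p) (topAfter none r) m
  at-end m rewrite top = relabel-step-value x≤t c p m

_·_ : (Class → ℚ) → (Class → ℚ) → ℚ
u · p = u free * p free + u paired * p paired + u taken * p taken

total : (Class → ℚ) → ℚ
total N = N free + N paired + N taken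

grow : ℚ → ℚ → (Class → ℚ) → Class → ℚ
grow T c N free   = (T + 1ℚ - (c + c)) * N free + N paired + N taken
grow T c N paired = (T - 1ℚ) * N paired + (c + c) * N free
grow T c N taken  = T * N taken + N paired

countStep : ℕ → ℚ → (Class → ℚ) → Class → ℚ
countStep zero    c N = N
countStep (suc t) c N = grow (fromℕ (suc t)) c N

countsFrom : ℕ → (Class → ℚ) → List ℚ → Class → ℚ
countsFrom t N []       = N
countsFrom t N (c ∷ cs) = countsFrom (suc t) (countStep t c N) cs

counts : List ℚ → Class → ℚ
counts = countsFrom 0 ⟨ 1ℚ , 0ℚ , 0ℚ ⟩

countsFrom-++ : ∀ t N xs ys → countsFrom t N (xs ++ ys) ≡ countsFrom (t ℕ.+ length xs) (countsFrom t N xs) ys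
countsFrom-++ t N []       ys rewrite ℕ.+-identityʳ t = refl
countsFrom-++ t N (x ∷ xs) ys rewrite ℕ.+-suc t (length xs) = countsFrom-++ (suc t) (countStep t x N) xs ys

∑-pullback : ∀ t c u p → ∑[ x < suc t ] (u · pullback t c (toℕ x) p) ≡ countStep t c u · p
∑-pullback zero    c u p = ℚ.+-identityʳ _
∑-pullback (suc k) c u p = begin
  u · pullback (suc k) c 0 p + (u · pullback (suc k) c 1 p + ∑[ x < k ] (u · p))
    ≡⟨ cong (λ s → u · pullback (suc k) c 0 p + (u · pullback (suc k) c 1 p + s)) (∑-const k (u · p)) ⟩
  u · pullback (suc k) c 0 p + (u · pullback (suc k) c 1 p + fromℕ k * (u · p))
    ≡⟨ coefficients (u free) (u paired) (u taken) (p free) (p paired) (p taken) c (fromℕ k) ⟩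
  grow (1ℚ + fromℕ k) c u · p ∎
  where
  open ≡-Reasoning
  coefficients : ∀ a b d A B C c e → let m = c * B + (1ℚ - c) * A in
    (a * m + b * A + d * A) + ((a * m + b * C + d * C) + e * (a * A + b * B + d * C))
      ≡ (((1ℚ + e) + 1ℚ - (c + c)) * a + b + d) * A + (((1ℚ + e) - 1ℚ) * b + (c + c) * a) * B
        + ((1ℚ + e) * d + b) * C
  coefficients = solve-∀ ℚ-ring

∑-run-value : ∀ t cs → length cs ≡ t → ∀ p → ∑[ q ∈ arrivalOrders t ] run cs q (value p) none [] ≡ counts cs · p
∑-run-value zero    [] _ p = no-arrival (p free) (p paired) (p taken)
  where
  no-arrival : ∀ a b d → a + 0ℚ ≡ 1ℚ * a + 0ℚ * b + 0ℚ * d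
  no-arrival = solve-∀ ℚ-ring
∑-run-value (suc t) cs len p with initLast cs
... | []       = contradiction len λ ()
... | cs′ ∷ʳ′ c = begin
  ∑[ q ∈ arrivalOrders (suc t) ] run (cs′ ∷ʳ c) q (value p) none []
    ≡⟨ ∑-arrivalOrders-∷ʳ t _ ⟩
  ∑[ x < suc t ] ∑[ r ∈ arrivalOrders t ] run (cs′ ∷ʳ c) (map (punchIn (toℕ x)) r ∷ʳ toℕ x) (value p) none []
    ≡⟨ sum-cong-≗ {suc t} (λ x → ∑-cong (All.map (λ {r} → run-last-arrival (Fin.toℕ≤pred[n] x) cs′ c p r len′)
                                                  (arrivalOrders-shape t))) ⟩
  ∑[ x < suc t ] ∑[ r ∈ arrivalOrders t ] run cs′ r (value (pullback t c (toℕ x) p)) none []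
    ≡⟨ sum-cong-≗ {suc t} (λ x → ∑-run-value t cs′ len′ (pullback t c (toℕ x) p)) ⟩
  ∑[ x < suc t ] (counts cs′ · pullback t c (toℕ x) p)
    ≡⟨ ∑-pullback t c (counts cs′) p ⟩
  countStep t c (counts cs′) · p
    ≡⟨ cong (λ N → N · p) counts-∷ʳ ⟨
  counts (cs′ ∷ʳ c) · p ∎
  where
  open ≡-Reasoning
  len′ : length cs′ ≡ t
  len′ = ℕ.suc-injective (trans (trans (ℕ.+-comm 1 (length cs′)) (sym (List.length-++ cs′))) len)
  counts-∷ʳ : counts (cs′ ∷ʳ c) ≡ countStep t c (counts cs′)
  counts-∷ʳ = trans (countsFrom-++ 0 _ cs′ (c ∷ [])) (cong (λ k → countStep k c (counts cs′)) len′)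

size-arrivalOrders : ∀ t cs → length cs ≡ t → fromℕ (length (arrivalOrders t)) ≡ total (counts cs)
size-arrivalOrders t cs len = begin
  fromℕ (length orders)                               ≡⟨ ∑-one orders ⟨
  ∑[ q ∈ orders ] 1ℚ                                  ≡⟨ ∑-cong-≗ (λ q → run-one cs q none []) orders ⟨
  ∑[ q ∈ orders ] run cs q (value (λ _ → 1ℚ)) none [] ≡⟨ ∑-run-value t cs len (λ _ → 1ℚ) ⟩
  counts cs · (λ _ → 1ℚ)                               ≡⟨ ·-one (counts cs free) (counts cs paired) (counts cs taken) ⟩
  total (counts cs)                                   ∎
  where
  open ≡-Reasoning
  orders = arrivalOrders t
  ∑-one : ∀ (xs : List (List ℕ)) → ∑[ x ∈ xs ] 1ℚ ≡ fromℕ (length xs)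
  ∑-one []       = refl
  ∑-one (_ ∷ xs) = cong (λ s → 1ℚ + s) (∑-one xs)
  ·-one : ∀ a b d → a * 1ℚ + b * 1ℚ + d * 1ℚ ≡ a + b + d
  ·-one = solve-∀ ℚ-ring

onlyPaired : Class → ℚ
onlyPaired paired = 1ℚ
onlyPaired _      = 0ℚ

∑-success : ∀ t cs → length cs ≡ suc (suc t) →
            ∑[ q ∈ arrivalOrders (suc (suc t)) ] simulate none [] cs q ≡ counts cs paired
∑-success t cs len = begin
  ∑[ q ∈ arrivalOrders (suc (suc t)) ] simulate none [] cs q
    ≡⟨ ∑-cong-≗ (λ q → simulate≡run cs q none []) (arrivalOrders (suc (suc t))) ⟩
  ∑[ q ∈ arrivalOrders (suc (suc t)) ] run cs q success none []
    ≡⟨ ∑-cong (All.map (λ {q} (len-q , top) → run-cong cs q none [] (trans len (sym len-q)) (at-end top))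
                       (arrivalOrders-shape (suc (suc t)))) ⟩
  ∑[ q ∈ arrivalOrders (suc (suc t)) ] run cs q (value onlyPaired) none []
    ≡⟨ ∑-run-value (suc (suc t)) cs len onlyPaired ⟩
  counts cs · onlyPaired
    ≡⟨ ·-onlyPaired (counts cs free) (counts cs paired) (counts cs taken) ⟩
  counts cs paired ∎
  where
  open ≡-Reasoning
  at-end : ∀ {s} → s ≡ two 0 1 → ∀ m → success s m ≡ value onlyPaired s m
  at-end refl m rewrite topTwoMatched≡pairIn m with pairIn 0 1 m | isMatched 0 m
  ... | true  | _     = refl
  ... | false | true  = refl
  ... | false | false = refl
  ·-onlyPaired : ∀ a b d → a * 0ℚ + b * 1ℚ + d * 0ℚ ≡ b
  ·-onlyPaired = solve-∀ ℚ-ring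

-- The potential

2ℚ 3ℚ 4ℚ : ℚ
2ℚ = (+ 2) / 1
3ℚ = (+ 3) / 1
4ℚ = (+ 4) / 1

fall₂ fall₃ : ℚ → ℚ
fall₂ x = x * (x - 1ℚ)
fall₃ x = x * (x - 1ℚ) * (x - 2ℚ)

0≤fall₂ : ∀ {x} → 1ℚ ≤ℚ x → 0ℚ ≤ℚ fall₂ x
0≤fall₂ 1≤x = 0≤* (ℚ.≤-trans (ℚ.nonNegative⁻¹ 1ℚ) 1≤x) (0≤- 1≤x)

potential : ℚ → ℚ → Class → ℚ
potential n T free   = fall₃ n + 3ℚ * (n - 2ℚ) * fall₂ T - 4ℚ * fall₃ T
potential n T paired = fall₃ n + 2ℚ * fall₃ T
potential n T taken  = fall₃ n - 3ℚ * (n - 2ℚ) * fall₂ T + 2ℚ * fall₃ T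

potential-step : ∀ n T c N →
  (1ℚ + T) * (N · potential n T)
    ≡ grow T c N · potential n (1ℚ + T) + N free * ((2ℚ - (c + c)) * (3ℚ * T * (1ℚ + T) * (T + T - n)))
potential-step n T c N = expanded (N free) (N paired) (N taken) n T c
  where
  -- The ring solver treats defined functions as opaque, so the definitions are unfolded by hand.
  expanded : ∀ a b d n T c →
    let f₂ = λ x → x * (x - 1ℚ)
        f₃ = λ x → x * (x - 1ℚ) * (x - 2ℚ)
        W₁ = λ T → f₃ n + 3ℚ * (n - 2ℚ) * f₂ T - 4ℚ * f₃ T
        W₂ = λ T → f₃ n + 2ℚ * f₃ T
        W₃ = λ T → f₃ n - 3ℚ * (n - 2ℚ) * f₂ T + 2ℚ * f₃ T
    in (1ℚ + T) * (a * W₁ T + b * W₂ T + d * W₃ T)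
         ≡ ((T + 1ℚ - (c + c)) * a + b + d) * W₁ (1ℚ + T) + ((T - 1ℚ) * b + (c + c) * a) * W₂ (1ℚ + T)
           + (T * d + b) * W₃ (1ℚ + T) + a * ((2ℚ - (c + c)) * (3ℚ * T * (1ℚ + T) * (T + T - n)))
  expanded = solve-∀ ℚ-ring

potential-final : ∀ n N → N · potential n n ≡ 3ℚ * fall₃ n * N paired
potential-final n N = expanded (N free) (N paired) (N taken) n
  where
  expanded : ∀ a b d n →
    let f₂ = λ x → x * (x - 1ℚ)
        f₃ = λ x → x * (x - 1ℚ) * (x - 2ℚ)
    in a * (f₃ n + 3ℚ * (n - 2ℚ) * f₂ n - 4ℚ * f₃ n) + b * (f₃ n + 2ℚ * f₃ n)
       + d * (f₃ n - 3ℚ * (n - 2ℚ) * f₂ n + 2ℚ * f₃ n)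
         ≡ 3ℚ * f₃ n * b
  expanded = solve-∀ ℚ-ring

potential-≤-free : ∀ {n T} → 1ℚ ≤ℚ T → T ≤ℚ n → T + T ≤ℚ n + 2ℚ → ∀ k → potential n T k ≤ℚ potential n T free
potential-≤-free         1≤T T≤n 2T≤n+2 free   = ℚ.≤-refl
potential-≤-free {n} {T} 1≤T T≤n 2T≤n+2 paired =
  ≤-by-slack _ (0≤* (0≤* (ℚ.nonNegative⁻¹ 3ℚ) (0≤fall₂ 1≤T)) (0≤- 2T≤n+2)) (expanded n T)
  where
  expanded : ∀ n T → let f₂ = λ x → x * (x - 1ℚ) ; f₃ = λ x → x * (x - 1ℚ) * (x - 2ℚ) in
    f₃ n + 3ℚ * (n - 2ℚ) * f₂ T - 4ℚ * f₃ T ≡ (f₃ n + 2ℚ * f₃ T) + 3ℚ * f₂ T * (n + 2ℚ - (T + T))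
  expanded = solve-∀ ℚ-ring
potential-≤-free {n} {T} 1≤T T≤n 2T≤n+2 taken  =
  ≤-by-slack _ (0≤* (0≤* (ℚ.nonNegative⁻¹ ((+ 6) / 1)) (0≤fall₂ 1≤T)) (0≤- T≤n)) (expanded n T)
  where
  expanded : ∀ n T → let f₂ = λ x → x * (x - 1ℚ) ; f₃ = λ x → x * (x - 1ℚ) * (x - 2ℚ) in
    f₃ n + 3ℚ * (n - 2ℚ) * f₂ T - 4ℚ * f₃ T
      ≡ (f₃ n - 3ℚ * (n - 2ℚ) * f₂ T + 2ℚ * f₃ T) + (+ 6) / 1 * f₂ T * (n - T)
  expanded = solve-∀ ℚ-ring

total-grow : ∀ T c N → total (grow T c N) ≡ (1ℚ + T) * total N
total-grow T c N = expanded (N free) (N paired) (N taken) T c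
  where
  expanded : ∀ a b d T c →
    ((T + 1ℚ - (c + c)) * a + b + d) + ((T - 1ℚ) * b + (c + c) * a) + (T * d + b) ≡ (1ℚ + T) * (a + b + d)
  expanded = solve-∀ ℚ-ring

InUnit : ℚ → Set
InUnit c = 0ℚ ≤ℚ c × c ≤ℚ 1ℚ

Nonneg : (Class → ℚ) → Set
Nonneg N = ∀ k → 0ℚ ≤ℚ N k

total-nonneg : ∀ {N} → Nonneg N → 0ℚ ≤ℚ total N
total-nonneg N≥0 = 0≤+ (0≤+ (N≥0 free) (N≥0 paired)) (N≥0 taken)

grow-nonneg : ∀ T c N → 1ℚ ≤ℚ T → InUnit c → Nonneg N → Nonneg (grow T c N)
grow-nonneg T c N 1≤T (0≤c , c≤1) N≥0 free   =
  0≤+ (0≤+ (0≤* 0≤coefficient (N≥0 free)) (N≥0 paired)) (N≥0 taken)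
  where
  rearrange : ∀ T c → T + 1ℚ - (c + c) ≡ (T - 1ℚ) + ((1ℚ - c) + (1ℚ - c))
  rearrange = solve-∀ ℚ-ring
  0≤coefficient : 0ℚ ≤ℚ T + 1ℚ - (c + c)
  0≤coefficient = subst (0ℚ ≤ℚ_) (sym (rearrange T c)) (0≤+ (0≤- 1≤T) (0≤+ (0≤- c≤1) (0≤- c≤1)))
grow-nonneg T c N 1≤T (0≤c , c≤1) N≥0 paired = 0≤+ (0≤* (0≤- 1≤T) (N≥0 paired)) (0≤* (0≤+ 0≤c 0≤c) (N≥0 free))
grow-nonneg T c N 1≤T (0≤c , c≤1) N≥0 taken  =
  0≤+ (0≤* (ℚ.≤-trans (ℚ.nonNegative⁻¹ 1ℚ) 1≤T) (N≥0 taken)) (N≥0 paired)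

countsFrom-nonneg : ∀ t N cs → All InUnit cs → Nonneg N → Nonneg (countsFrom t N cs)
countsFrom-nonneg t       N []       []         N≥0 = N≥0
countsFrom-nonneg zero    N (c ∷ cs) (_ ∷ cs∈)  N≥0 = countsFrom-nonneg 1 N cs cs∈ N≥0
countsFrom-nonneg (suc t) N (c ∷ cs) (c∈ ∷ cs∈) N≥0 =
  countsFrom-nonneg (suc (suc t)) _ cs cs∈ (grow-nonneg _ c N (p≤p+q 1ℚ (0≤fromℕ t)) c∈ N≥0)

initial-nonneg : Nonneg ⟨ 1ℚ , 0ℚ , 0ℚ ⟩
initial-nonneg free   = ℚ.nonNegative⁻¹ 1ℚ
initial-nonneg paired = ℚ.≤-refl
initial-nonneg taken  = ℚ.≤-refl

potential-grow-≤ : ∀ n T c N → 0ℚ ≤ℚ T → n ≤ℚ T + T → c ≤ℚ 1ℚ → 0ℚ ≤ℚ N free →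
                   grow T c N · potential n (1ℚ + T) ≤ℚ (1ℚ + T) * (N · potential n T)
potential-grow-≤ n T c N 0≤T n≤2T c≤1 0≤N = ≤-by-slack _ (0≤* 0≤N (0≤* 0≤2-2c 0≤rest)) (potential-step n T c N)
  where
  0≤2-2c : 0ℚ ≤ℚ 2ℚ - (c + c)
  0≤2-2c = 0≤- (ℚ.+-mono-≤ c≤1 c≤1)
  0≤rest : 0ℚ ≤ℚ 3ℚ * T * (1ℚ + T) * (T + T - n)
  0≤rest = 0≤* (0≤* (0≤* (ℚ.nonNegative⁻¹ 3ℚ) 0≤T) (0≤+ (ℚ.nonNegative⁻¹ 1ℚ) 0≤T)) (0≤- n≤2T)

·-≤-total : ∀ N W M → Nonneg N → (∀ k → W k ≤ℚ M) → N · W ≤ℚ M * total N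
·-≤-total N W M N≥0 W≤M = ℚ.≤-trans
  (ℚ.+-mono-≤ (ℚ.+-mono-≤ (*-monoˡ-≤ (N≥0 free) (W≤M free)) (*-monoˡ-≤ (N≥0 paired) (W≤M paired)))
              (*-monoˡ-≤ (N≥0 taken) (W≤M taken)))
  (ℚ.≤-reflexive (factor (N free) (N paired) (N taken) M))
  where
  factor : ∀ a b d M → a * M + b * M + d * M ≡ M * (a + b + d)
  factor = solve-∀ ℚ-ring

ψ : ℕ → ℕ → (Class → ℚ) → ℚ
ψ n t N = N · potential (fromℕ n) (fromℕ t)

countsFrom-ψ-≤ : ∀ n M t N cs → 1 ≤ t → n ≤ t ℕ.+ t → Nonneg N → All InUnit cs → ψ n t N ≤ℚ M * total N →
                 ψ n (t ℕ.+ length cs) (countsFrom t N cs) ≤ℚ M * total (countsFrom t N cs)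
countsFrom-ψ-≤ n M t N [] _ _ _ _ ψ≤ rewrite ℕ.+-identityʳ t = ψ≤
countsFrom-ψ-≤ n M (suc t) N (c ∷ cs) _ n≤2t N≥0 (c∈ ∷ cs∈) ψ≤ rewrite ℕ.+-suc t (length cs) =
  countsFrom-ψ-≤ n M (suc (suc t)) N′ cs (s≤s z≤n) (ℕ.≤-trans n≤2t (ℕ.+-mono-≤ (ℕ.n≤1+n (suc t)) (ℕ.n≤1+n (suc t))))
    (grow-nonneg T c N 1≤T c∈ N≥0) cs∈ (begin
      ψ n (suc (suc t)) N′      ≤⟨ potential-grow-≤ (fromℕ n) T c N (0≤fromℕ (suc t)) n≤2T (proj₂ c∈) (N≥0 free) ⟩
      (1ℚ + T) * ψ n (suc t) N  ≤⟨ *-monoˡ-≤ (0≤fromℕ (suc (suc t))) ψ≤ ⟩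
      (1ℚ + T) * (M * total N)  ≡⟨ ℚ.*-comm (1ℚ + T) _ ⟩
      (M * total N) * (1ℚ + T)  ≡⟨ ℚ.*-assoc M (total N) (1ℚ + T) ⟩
      M * (total N * (1ℚ + T))  ≡⟨ cong (M *_) (trans (ℚ.*-comm (total N) (1ℚ + T)) (sym (total-grow T c N))) ⟩
      M * total N′              ∎)
  where
  open ℚ.≤-Reasoning
  T  = fromℕ (suc t)
  N′ = grow T c N
  1≤T : 1ℚ ≤ℚ T
  1≤T = p≤p+q 1ℚ (0≤fromℕ t)
  n≤2T : fromℕ n ≤ℚ T + T
  n≤2T = ℚ.≤-trans (fromℕ-mono-≤ n≤2t) (ℚ.≤-reflexive (fromℕ-+ (suc t) (suc t)))

counts-ψ-≤ : ∀ n M T cs → 1 ≤ T → T ≤ length cs → n ≤ T ℕ.+ T → All InUnit cs →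
             (∀ k → potential (fromℕ n) (fromℕ T) k ≤ℚ M) → ψ n (length cs) (counts cs) ≤ℚ M * total (counts cs)
counts-ψ-≤ n M T cs 1≤T T≤len n≤2T cs∈ W≤M =
  subst₂ (λ t N → ψ n t N ≤ℚ M * total N) len≡ counts≡
    (countsFrom-ψ-≤ n M T N₀ (drop T cs) 1≤T n≤2T N₀-nonneg (All.drop⁺ T cs∈) (·-≤-total N₀ _ M N₀-nonneg W≤M))
  where
  N₀ = counts (take T cs)
  N₀-nonneg : Nonneg N₀
  N₀-nonneg = countsFrom-nonneg 0 _ (take T cs) (All.take⁺ T cs∈) initial-nonneg
  len-take : length (take T cs) ≡ T
  len-take = trans (List.length-take T cs) (ℕ.m≤n⇒m⊓n≡m T≤len)
  len≡ : T ℕ.+ length (drop T cs) ≡ length cs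
  len≡ = trans (cong (T ℕ.+_) (List.length-drop T cs)) (ℕ.m+[n∸m]≡n T≤len)
  counts≡ : countsFrom T N₀ (drop T cs) ≡ counts cs
  counts≡ = sym (trans (cong counts (sym (List.take++drop≡id T cs)))
                       (trans (countsFrom-++ 0 _ (take T cs) (drop T cs))
                              (cong (λ t → countsFrom t N₀ (drop T cs)) len-take)))

-- The midpoint

target : ℚ → ℚ
target n = (+ 5) / 4 * fall₃ n + (+ 6) / 1 * ((n - 1ℚ) * (n - 2ℚ))

target≡ : ∀ n ι → n * ι ≡ 1ℚ → 3ℚ * fall₃ n * ((+ 5) / 12 + 2ℚ * ι) ≡ target n
target≡ n ι nι≡1 = begin
  3ℚ * fall₃ n * ((+ 5) / 12 + 2ℚ * ι)      ≡⟨ expanded n ι ⟩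
  (+ 5) / 4 * fall₃ n + quadratic * (n * ι)  ≡⟨ cong (λ x → (+ 5) / 4 * fall₃ n + quadratic * x) nι≡1 ⟩
  (+ 5) / 4 * fall₃ n + quadratic * 1ℚ       ≡⟨ cong (λ x → (+ 5) / 4 * fall₃ n + x) (ℚ.*-identityʳ quadratic) ⟩
  target n                                   ∎
  where
  open ≡-Reasoning
  quadratic = (+ 6) / 1 * ((n - 1ℚ) * (n - 2ℚ))
  expanded : ∀ n ι → let f₃ = λ x → x * (x - 1ℚ) * (x - 2ℚ) in
    3ℚ * f₃ n * ((+ 5) / 12 + 2ℚ * ι) ≡ (+ 5) / 4 * f₃ n + (+ 6) / 1 * ((n - 1ℚ) * (n - 2ℚ)) * (n * ι)
  expanded = solve-∀ ℚ-ring

potential-≤-free-ℕ : ∀ {n T} → 1 ≤ T → T ≤ n → T ℕ.+ T ≤ 2 ℕ.+ n →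
                     ∀ k → potential (fromℕ n) (fromℕ T) k ≤ℚ potential (fromℕ n) (fromℕ T) free
potential-≤-free-ℕ {n} {T} 1≤T T≤n 2T≤n+2 = potential-≤-free (fromℕ-mono-≤ 1≤T) (fromℕ-mono-≤ T≤n)
  (ℚ.≤-trans (ℚ.≤-reflexive (sym (fromℕ-+ T T)))
    (ℚ.≤-trans (fromℕ-mono-≤ 2T≤n+2) (ℚ.≤-reflexive (trans (fromℕ-+ 2 n) (ℚ.+-comm (fromℕ 2) (fromℕ n))))))

0≤gap : ∀ {a e} → 0ℚ ≤ℚ a → 0ℚ ≤ℚ e → 0ℚ ≤ℚ (1ℚ + e) * (a + (+ 21) / 1 * e)
0≤gap 0≤a 0≤e = 0≤* (0≤+ (ℚ.nonNegative⁻¹ 1ℚ) 0≤e) (0≤+ 0≤a (0≤* (ℚ.nonNegative⁻¹ ((+ 21) / 1)) 0≤e))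

free-≤-target-odd : ∀ h → let n = fromℕ (3 ℕ.+ (h ℕ.+ h)) in potential n (fromℕ (2 ℕ.+ h)) free ≤ℚ target n
free-≤-target-odd h = subst (λ n → potential n (fromℕ (2 ℕ.+ h)) free ≤ℚ target n) (sym n≡2T-1)
  (≤-by-slack _ (0≤gap (ℚ.nonNegative⁻¹ ((+ 15) / 2)) (0≤fromℕ h)) (expanded (fromℕ h)))
  where
  rearrange : ∀ e → 1ℚ + (1ℚ + (1ℚ + (e + e))) ≡ (1ℚ + (1ℚ + e)) + (1ℚ + (1ℚ + e)) - 1ℚ
  rearrange = solve-∀ ℚ-ring
  n≡2T-1 : fromℕ (3 ℕ.+ (h ℕ.+ h)) ≡ fromℕ (2 ℕ.+ h) + fromℕ (2 ℕ.+ h) - 1ℚ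
  n≡2T-1 = trans (cong (λ x → 1ℚ + (1ℚ + (1ℚ + x))) (fromℕ-+ h h)) (rearrange (fromℕ h))
  expanded : ∀ e → let T = 1ℚ + (1ℚ + e) ; n = T + T - 1ℚ
                       f₂ = λ x → x * (x - 1ℚ) ; f₃ = λ x → x * (x - 1ℚ) * (x - 2ℚ) in
    (+ 5) / 4 * f₃ n + (+ 6) / 1 * ((n - 1ℚ) * (n - 2ℚ))
      ≡ (f₃ n + 3ℚ * (n - 2ℚ) * f₂ T - 4ℚ * f₃ T) + (1ℚ + e) * ((+ 15) / 2 + (+ 21) / 1 * e)
  expanded = solve-∀ ℚ-ring

free-≤-target-even : ∀ h → let n = fromℕ (4 ℕ.+ (h ℕ.+ h)) in potential n (fromℕ (2 ℕ.+ h)) free ≤ℚ target n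
free-≤-target-even h = subst (λ n → potential n (fromℕ (2 ℕ.+ h)) free ≤ℚ target n) (sym n≡2T)
  (≤-by-slack _ (0≤gap (ℚ.nonNegative⁻¹ ((+ 30) / 1)) (0≤fromℕ h)) (expanded (fromℕ h)))
  where
  rearrange : ∀ e → 1ℚ + (1ℚ + (1ℚ + (1ℚ + (e + e)))) ≡ (1ℚ + (1ℚ + e)) + (1ℚ + (1ℚ + e))
  rearrange = solve-∀ ℚ-ring
  n≡2T : fromℕ (4 ℕ.+ (h ℕ.+ h)) ≡ fromℕ (2 ℕ.+ h) + fromℕ (2 ℕ.+ h)
  n≡2T = trans (cong (λ x → 1ℚ + (1ℚ + (1ℚ + (1ℚ + x)))) (fromℕ-+ h h)) (rearrange (fromℕ h))
  expanded : ∀ e → let T = 1ℚ + (1ℚ + e) ; n = T + T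
                       f₂ = λ x → x * (x - 1ℚ) ; f₃ = λ x → x * (x - 1ℚ) * (x - 2ℚ) in
    (+ 5) / 4 * f₃ n + (+ 6) / 1 * ((n - 1ℚ) * (n - 2ℚ))
      ≡ (f₃ n + 3ℚ * (n - 2ℚ) * f₂ T - 4ℚ * f₃ T) + (1ℚ + e) * ((+ 30) / 1 + (+ 21) / 1 * e)
  expanded = solve-∀ ℚ-ring

halve : ∀ m → Σ ℕ λ h → m ≡ h ℕ.+ h ⊎ m ≡ suc (h ℕ.+ h)
halve zero          = 0 , inj₁ refl
halve (suc zero)    = 0 , inj₂ refl
halve (suc (suc m)) with halve m
... | h , inj₁ m≡2h   = suc h , inj₁ (cong suc (trans (cong suc m≡2h) (sym (ℕ.+-suc h h))))
... | h , inj₂ m≡2h+1 = suc h , inj₂ (cong suc (trans (cong suc m≡2h+1) (cong suc (sym (ℕ.+-suc h h)))))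

double : ∀ h → (2 ℕ.+ h) ℕ.+ (2 ℕ.+ h) ≡ 4 ℕ.+ (h ℕ.+ h)
double h = cong (2 ℕ.+_) (trans (ℕ.+-suc h (suc h)) (cong suc (ℕ.+-suc h h)))

midpoint : ∀ m → Σ ℕ λ T → 1 ≤ T × T ≤ 3 ℕ.+ m × 3 ℕ.+ m ≤ T ℕ.+ T ×
                           (∀ k → potential (fromℕ (3 ℕ.+ m)) (fromℕ T) k ≤ℚ target (fromℕ (3 ℕ.+ m)))
midpoint m with halve m
... | h , inj₁ refl = 2 ℕ.+ h , s≤s z≤n , T≤n , n≤2T ,
  λ k → ℚ.≤-trans (potential-≤-free-ℕ (s≤s z≤n) T≤n 2T≤n+2 k) (free-≤-target-odd h)
  where
  T≤n : 2 ℕ.+ h ≤ 3 ℕ.+ (h ℕ.+ h)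
  T≤n = s≤s (s≤s (ℕ.≤-trans (ℕ.m≤m+n h h) (ℕ.n≤1+n _)))
  n≤2T : 3 ℕ.+ (h ℕ.+ h) ≤ (2 ℕ.+ h) ℕ.+ (2 ℕ.+ h)
  n≤2T = ℕ.≤-trans (ℕ.n≤1+n _) (ℕ.≤-reflexive (sym (double h)))
  2T≤n+2 : (2 ℕ.+ h) ℕ.+ (2 ℕ.+ h) ≤ 2 ℕ.+ (3 ℕ.+ (h ℕ.+ h))
  2T≤n+2 = ℕ.≤-trans (ℕ.≤-reflexive (double h)) (ℕ.n≤1+n _)
... | h , inj₂ refl = 2 ℕ.+ h , s≤s z≤n , T≤n , ℕ.≤-reflexive (sym (double h)) ,
  λ k → ℚ.≤-trans (potential-≤-free-ℕ (s≤s z≤n) T≤n 2T≤n+2 k) (free-≤-target-even h)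
  where
  T≤n : 2 ℕ.+ h ≤ 4 ℕ.+ (h ℕ.+ h)
  T≤n = s≤s (s≤s (ℕ.≤-trans (ℕ.m≤m+n h h) (ℕ.m≤n+m _ 2)))
  2T≤n+2 : (2 ℕ.+ h) ℕ.+ (2 ℕ.+ h) ≤ 2 ℕ.+ (4 ℕ.+ (h ℕ.+ h))
  2T≤n+2 = ℕ.≤-trans (ℕ.≤-reflexive (double h)) (ℕ.m≤n+m _ 2)

fall₃-pos : ∀ m → 0ℚ < 3ℚ * fall₃ (fromℕ (3 ℕ.+ m))
fall₃-pos m = subst (0ℚ <_) (sym (expanded x))
  (ℚ.<-≤-trans (ℚ.positive⁻¹ ((+ 18) / 1)) (p≤p+q ((+ 18) / 1) (0≤* (0≤fromℕ m) 0≤tail)))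
  where
  x = fromℕ m
  0≤tail : 0ℚ ≤ℚ (+ 33) / 1 + x * ((+ 18) / 1 + 3ℚ * x)
  0≤tail = 0≤+ (ℚ.nonNegative⁻¹ _)
               (0≤* (0≤fromℕ m) (0≤+ (ℚ.nonNegative⁻¹ _) (0≤* (ℚ.nonNegative⁻¹ 3ℚ) (0≤fromℕ m))))
  expanded : ∀ x → let n = 1ℚ + (1ℚ + (1ℚ + x)) in
    3ℚ * (n * (n - 1ℚ) * (n - 2ℚ)) ≡ (+ 18) / 1 + x * ((+ 33) / 1 + x * ((+ 18) / 1 + 3ℚ * x))
  expanded = solve-∀ ℚ-ring

successBound : ℕ → ℚ
successBound n = (+ 5) / 12 + 2ℚ * inv n

0≤successBound : ∀ n → 0ℚ ≤ℚ successBound n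
0≤successBound zero    = 0≤+ (ℚ.nonNegative⁻¹ ((+ 5) / 12)) (0≤* (ℚ.nonNegative⁻¹ 2ℚ) ℚ.≤-refl)
0≤successBound (suc n) = 0≤+ (ℚ.nonNegative⁻¹ ((+ 5) / 12))
                             (0≤* (ℚ.nonNegative⁻¹ 2ℚ) (ℚ.nonNegative⁻¹ (inv (suc n)) {{ℚ.normalize-nonNeg 1 (suc n)}}))

counts-paired-≤ : ∀ m cs → length cs ≡ 3 ℕ.+ m → All InUnit cs →
                  counts cs paired ≤ℚ successBound (3 ℕ.+ m) * total (counts cs)
counts-paired-≤ m cs len cs∈ with midpoint m
... | T , 1≤T , T≤n , n≤2T , W≤target = ℚ.*-cancelˡ-≤-pos r {{positive (fall₃-pos m)}} (begin
  r * counts cs paired                      ≡⟨ potential-final (fromℕ n) (counts cs) ⟨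
  ψ n n (counts cs)                         ≡⟨ cong (λ t → ψ n t (counts cs)) len ⟨
  ψ n (length cs) (counts cs)               ≤⟨ counts-ψ-≤ n _ T cs 1≤T (subst (T ≤_) (sym len) T≤n) n≤2T cs∈ W≤target ⟩
  target (fromℕ n) * total (counts cs)      ≡⟨ cong (_* total (counts cs)) (target≡ (fromℕ n) (inv n) n*inv≡1) ⟨
  r * successBound n * total (counts cs)    ≡⟨ ℚ.*-assoc r (successBound n) _ ⟩
  r * (successBound n * total (counts cs))  ∎)
  where
  open ℚ.≤-Reasoning
  n = 3 ℕ.+ m
  r = 3ℚ * fall₃ (fromℕ n)
  n*inv≡1 = fromℕ*inv≡1 (2 ℕ.+ m)

counts-paired-≤-total : ∀ {k} cs → 1ℚ ≤ℚ k → All InUnit cs → counts cs paired ≤ℚ k * total (counts cs)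
counts-paired-≤-total {k} cs 1≤k cs∈ = begin
  N paired                      ≤⟨ ≤-by-slack _ (0≤+ (N≥0 free) (N≥0 taken)) (rearrange (N free) (N paired) (N taken)) ⟩
  total N                       ≡⟨ ℚ.*-identityˡ (total N) ⟨
  1ℚ * total N                  ≤⟨ ℚ.*-monoʳ-≤-nonNeg (total N) {{nonNegative (total-nonneg N≥0)}} 1≤k ⟩
  k * total N                   ∎
  where
  open ℚ.≤-Reasoning
  N = counts cs
  N≥0 : Nonneg N
  N≥0 = countsFrom-nonneg 0 _ cs cs∈ initial-nonneg
  rearrange : ∀ a b d → a + b + d ≡ b + (a + d)
  rearrange = solve-∀ ℚ-ring

average-≤ : ∀ {k} xs → 0ℚ ≤ℚ k → ∑ xs ≤ℚ k * fromℕ (length xs) → average xs ≤ℚ k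
average-≤ {k} xs 0≤k ∑≤ with length xs
... | zero  = 0≤k
... | suc l = begin
  ∑ xs * inv (suc l)                 ≤⟨ ℚ.*-monoʳ-≤-nonNeg (inv (suc l)) {{ℚ.normalize-nonNeg 1 (suc l)}} ∑≤ ⟩
  k * fromℕ (suc l) * inv (suc l)    ≡⟨ ℚ.*-assoc k (fromℕ (suc l)) (inv (suc l)) ⟩
  k * (fromℕ (suc l) * inv (suc l))  ≡⟨ cong (k *_) (fromℕ*inv≡1 l) ⟩
  k * 1ℚ                             ≡⟨ ℚ.*-identityʳ k ⟩
  k                                  ∎
  where open ℚ.≤-Reasoning

successProb-≤ : ∀ t cs {k} → length cs ≡ 2 ℕ.+ t → 0ℚ ≤ℚ k → counts cs paired ≤ℚ k * total (counts cs) →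
                successProb (2 ℕ.+ t) cs ≤ℚ k
successProb-≤ t cs {k} len 0≤k paired≤ = average-≤ (map (simulate none [] cs) orders) 0≤k (begin
  ∑[ q ∈ orders ] simulate none [] cs q                 ≡⟨ ∑-success t cs len ⟩
  counts cs paired                                      ≤⟨ paired≤ ⟩
  k * total (counts cs)                                 ≡⟨ cong (k *_) (size-arrivalOrders (2 ℕ.+ t) cs len) ⟨
  k * fromℕ (length orders)                             ≡⟨ cong (λ l → k * fromℕ l) (List.length-map _ orders) ⟨
  k * fromℕ (length (map (simulate none [] cs) orders)) ∎)
  where
  open ℚ.≤-Reasoning
  orders = arrivalOrders (2 ℕ.+ t)

theorem9 : Σ ℚ (λ C → (n : ℕ) → 1 ≤ n → (c : Vec ℚ n) →
             ((i : Fin n) → (0ℚ ≤ℚ lookup c i) × (lookup c i ≤ℚ 1ℚ)) →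
             successProb n (toList c) ≤ℚ ((+ 5) / 12) + C * inv n)
theorem9 = 2ℚ , bound
  where
  units : ∀ {n} {c : Vec ℚ n} → (∀ i → InUnit (lookup c i)) → All InUnit (toList c)
  units c∈ = VecAll.toList⁺ (VecAll.lookup⁻ c∈)
  bound : ∀ n → 1 ≤ n → (c : Vec ℚ n) → (∀ i → InUnit (lookup c i)) → successProb n (toList c) ≤ℚ successBound n
  -- A single vertex is never matched: successProb 1 computes to 0ℚ.
  bound 1                   _ (_ Vec.∷ Vec.[]) _  = 0≤successBound 1
  bound 2                   _ c                c∈ =
    successProb-≤ 0 (toList c) (Vec.length-toList c) (0≤successBound 2)
                  (counts-paired-≤-total (toList c) (ℚ.≤ᵇ⇒≤ {1ℚ} {successBound 2} _) (units c∈))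
  bound (suc (suc (suc m))) _ c                c∈ =
    successProb-≤ (suc m) (toList c) (Vec.length-toList c) (0≤successBound (3 ℕ.+ m))
                  (counts-paired-≤ m (toList c) (Vec.length-toList c) (units c∈))
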